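{- $\mathcal A_{1} \cap \mathcal S \subseteq \mathcal{SL}$.
   Context: An $\mathcal I$-zroupoid is an algebra $\langle A,\to,0\rangle$ ($\to$ binary, $0$ constant) satisfying $(x \to y) \to z \approx [(z' \to x) \to (y \to z)']'$ and $0''\approx 0$, where $x' := x \to 0$; $\mathcal I$ is their variety. Put $x \wedge y := (x \to y')'$. $\mathcal S$ is the variety of $\mathcal I$-zroupoids satisfying $x''\approx x$ and $x\wedge y \approx y \wedge x$. $\mathcal A_{1}$ is the subvariety of $\mathcal I$ defined by the associative law $x \to (y \to z) \approx (x \to y) \to z$. $\mathcal{SL}$ is the subvariety of $\mathcal I$ defined by $x' \approx x$ and $x \to y \approx y \to x$. -}

module Defs where

open import Level using (Level; suc)
open import Relation.Binary.PropositionalEquality using (_≡_)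

record Zroupoid (a : Level) : Set (suc a) where
  field
    Carrier : Set a
    _⇒_     : Carrier → Carrier → Carrier
    𝟎       : Carrier

  infixr 5 _⇒_

  _′ : Carrier → Carrier
  x ′ = x ⇒ 𝟎

  infix 8 _′

  _∧_ : Carrier → Carrier → Carrier
  x ∧ y = (x ⇒ y ′) ′

module _ {a : Level} (Z : Zroupoid a) where
  open Zroupoid Z

  record IsIZroupoid : Set a where
    field
      identity-I : ∀ x y z → (x ⇒ y) ⇒ z ≡ (((z ′ ⇒ x) ⇒ (y ⇒ z) ′) ′)
      zero''     : 𝟎 ′ ′ ≡ 𝟎

  record InS : Set a where
    field
      isI     : IsIZroupoid
      dblNeg  : ∀ x → x ′ ′ ≡ x
      ∧-comm  : ∀ x y → x ∧ y ≡ y ∧ x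

  record InA1 : Set a where
    field
      isI   : IsIZroupoid
      assoc : ∀ x y z → x ⇒ (y ⇒ z) ≡ (x ⇒ y) ⇒ z

  record InSL : Set a where
    field
      isI     : IsIZroupoid
      neg-id  : ∀ x → x ′ ≡ x
      ⇒-comm  : ∀ x y → x ⇒ y ≡ y ⇒ x

-- In an associative 𝓘-zroupoid the axiom (x → y) → z ≈ ((z' → x) → (y → z)')'
-- collapses 0' to 0, so x' = x → 0' = x''. Under x'' ≈ x this makes ' the
-- identity, and associativity gives x ∧ y = (x → y)'' = x → y, so
-- commutativity of ∧ is commutativity of →.
module Submission where

open import Defs
open import Level using (Level)
open import Relation.Binary.PropositionalEquality

module A1-Properties {a : Level} (Z : Zroupoid a) (A : InA1 Z) where
  open Zroupoid Z
  open InA1 A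
  open IsIZroupoid isI
  open ≡-Reasoning

  ⇒𝟎′≡′′ : ∀ x → x ⇒ 𝟎 ′ ≡ x ′ ′
  ⇒𝟎′≡′′ x = assoc x 𝟎 𝟎

  ∧≡⇒′′ : ∀ x y → x ∧ y ≡ (x ⇒ y) ′ ′
  ∧≡⇒′′ x y = cong _′ (assoc x y 𝟎)

  𝟎′≡𝟎 : 𝟎 ′ ≡ 𝟎
  𝟎′≡𝟎 = begin
    𝟎 ′                                  ≡⟨ sym 𝟎′⇒𝟎′≡𝟎′ ⟩
    𝟎 ′ ⇒ 𝟎 ′                            ≡⟨ identity-I 𝟎 𝟎 (𝟎 ′) ⟩
    ((𝟎 ′ ′ ⇒ 𝟎) ⇒ (𝟎 ⇒ 𝟎 ′) ′) ′        ≡⟨ cong (λ w → ((w ⇒ 𝟎) ⇒ (𝟎 ⇒ 𝟎 ′) ′) ′) zero'' ⟩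
    (𝟎 ′ ⇒ (𝟎 ⇒ 𝟎 ′) ′) ′               ≡⟨ cong (λ w → (𝟎 ′ ⇒ w ′) ′) 𝟎⇒𝟎′≡𝟎 ⟩
    (𝟎 ′ ⇒ 𝟎 ′) ′                        ≡⟨ cong _′ 𝟎′⇒𝟎′≡𝟎′ ⟩
    𝟎 ′ ′                                ≡⟨ zero'' ⟩
    𝟎                                    ∎
    where
    𝟎⇒𝟎′≡𝟎 : 𝟎 ⇒ 𝟎 ′ ≡ 𝟎
    𝟎⇒𝟎′≡𝟎 = trans (⇒𝟎′≡′′ 𝟎) zero''

    𝟎′⇒𝟎′≡𝟎′ : 𝟎 ′ ⇒ 𝟎 ′ ≡ 𝟎 ′
    𝟎′⇒𝟎′≡𝟎′ = trans (⇒𝟎′≡′′ (𝟎 ′)) (cong _′ zero'')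

  ′′≡′ : ∀ x → x ′ ′ ≡ x ′
  ′′≡′ x = trans (sym (⇒𝟎′≡′′ x)) (cong (x ⇒_) 𝟎′≡𝟎)

module A1∩S-Properties {a : Level} (Z : Zroupoid a) (A : InA1 Z) (S : InS Z) where
  open Zroupoid Z
  open InS S using (dblNeg; ∧-comm)
  open A1-Properties Z A

  ′-id : ∀ x → x ′ ≡ x
  ′-id x = trans (sym (′′≡′ x)) (dblNeg x)

  ∧≡⇒ : ∀ x y → x ∧ y ≡ x ⇒ y
  ∧≡⇒ x y = trans (∧≡⇒′′ x y) (dblNeg (x ⇒ y))

  ⇒-comm : ∀ x y → x ⇒ y ≡ y ⇒ x
  ⇒-comm x y = begin
    x ⇒ y  ≡⟨ sym (∧≡⇒ x y) ⟩
    x ∧ y  ≡⟨ ∧-comm x y ⟩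
    y ∧ x  ≡⟨ ∧≡⇒ y x ⟩
    y ⇒ x  ∎
    where open ≡-Reasoning

lemma5p5 : ∀ {a : Level} (Z : Zroupoid a) → InA1 Z → InS Z → InSL Z
lemma5p5 Z A S = record
  { isI    = InA1.isI A
  ; neg-id = ′-id
  ; ⇒-comm = ⇒-comm
  }
  where open A1∩S-Properties Z A S
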